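{- Let $G\in\{T_1,T_2\}\cup\{C_k : k\ge 4\}$. For every labeling $f$ of $G$ (identifying $V(G)$ with $\{1,\ldots,|V(G)|\}$ via $f$), there exist vertices $k_1<k_2<k_3<k_4$ such that either $k_1k_3$ and $k_2k_4$ are both edges of $G$, or $k_1k_4$ and $k_2k_3$ are both edges of $G$.
   Context: A labeling of a graph $G$ with $n$ vertices is a bijection $f:V(G)\to\{1,\ldots,n\}$. $C_k$ is the cycle of length $k$. $T_1$ is the tree on 7 vertices consisting of a center vertex joined to three vertices, each of which is joined to one further (distinct) leaf (the claw with each edge subdivided once). $T_2$ is the graph on 6 vertices consisting of a triangle $abc$ together with three further vertices $a',b',c'$ and edges $aa',bb',cc'$. -}

module Defs where

open import Data.Nat using (ℕ; zero; suc; _∸_)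
open import Data.Fin using (Fin; toℕ; _<_; #_)
open import Data.Product using (_×_; _,_; ∃-syntax)
open import Data.Sum using (_⊎_)
open import Data.List using (List; []; _∷_)
open import Data.List.Membership.Propositional using (_∈_)
open import Function.Bundles using (_⤖_; Bijection)
open import Relation.Binary.PropositionalEquality using (_≡_)

-- A (finite, simple, undirected) graph on vertex set Fin n,
-- given by a symmetric irreflexive adjacency relation.
record Graph : Set₁ where
  field
    n   : ℕ
    Adj : Fin n → Fin n → Set
open Graph public

fromEdges : (n : ℕ) → List (Fin n × Fin n) → Graph
fromEdges n es = record { n = n ; Adj = λ u v → ((u , v) ∈ es) ⊎ ((v , u) ∈ es) }

C : ℕ → Graph
C k = record
  { n = k
  ; Adj = λ i j → (toℕ j ≡ suc (toℕ i)) ⊎ (toℕ i ≡ suc (toℕ j))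
                 ⊎ ((toℕ i ≡ 0) × (toℕ j ≡ k ∸ 1))
                 ⊎ ((toℕ j ≡ 0) × (toℕ i ≡ k ∸ 1)) }

-- T₁: the claw with each edge subdivided once.
-- centre 0; middle vertices 1,2,3; leaves 4,5,6 (4–1, 5–2, 6–3).
T₁ : Graph
T₁ = fromEdges 7
  ( (# 0 , # 1) ∷ (# 0 , # 2) ∷ (# 0 , # 3) ∷ (# 1 , # 4) ∷ (# 2 , # 5) ∷ (# 3 , # 6) ∷ [] )

-- T₂: triangle a b c = 0 1 2 with pendant vertices a' b' c' = 3 4 5.
T₂ : Graph
T₂ = fromEdges 6
  ( (# 0 , # 1) ∷ (# 1 , # 2) ∷ (# 0 , # 2) ∷ (# 0 , # 3) ∷ (# 1 , # 4) ∷ (# 2 , # 5) ∷ [] )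

-- A labeling of G: a bijection V(G) → {1,…,n} (here Fin n, i.e. {0,…,n-1};
-- only the order of labels matters).
Labeling : Graph → Set
Labeling G = Fin (n G) ⤖ Fin (n G)

HasPattern : (G : Graph) → Labeling G → Set
HasPattern G f =
  ∃[ u₁ ] ∃[ u₂ ] ∃[ u₃ ] ∃[ u₄ ]
    ((ℓ u₁ < ℓ u₂) × (ℓ u₂ < ℓ u₃) × (ℓ u₃ < ℓ u₄)) ×
    ((Adj G u₁ u₃ × Adj G u₂ u₄) ⊎ (Adj G u₁ u₄ × Adj G u₂ u₃))
  where ℓ = Bijection.to f

module Submission where

-- Call two vertex-disjoint edges *overlapping* if their label
-- intervals intersect; the required configuration (k₁k₃,k₂k₄ crossing or
-- k₁k₄,k₂k₃ nesting) is exactly a pair of overlapping disjoint edges.  The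
-- basic fact, 'overlap-pattern', is: if z lies strictly between the ends of
-- an edge xy and zw is an edge with w ∉ {x,z,y}, the two edges overlap.
-- Each graph is reduced to such a configuration inside the module 'Labelled':
--   * T₂ ('pendant-triangle'): the middle-labelled vertex of a triangle lies
--     between the ends of the opposite side, and its pendant edge leaves it.
--   * 'fork-pattern': in a walk u′–u–c–v–v′ with u, v on the same side of c,
--     whichever of u, v is nearer to c lies inside the edge from c to the
--     other, and its outer edge supplies w.
--   * T₁: two of the three neighbours of the centre lie on the same side of
--     it ('two-on-one-side'), and they span a fork.
--   * Cₖ, k ≥ 4 ('fork-at-minimum'): the vertex labelled 0 is the centre of a
--     fork whose inner vertices both lie above it; that every position of the
--     cycle is the centre of a fork is a case analysis ('cycle-fork-at').

open import Defs
open import Data.Nat using (ℕ; zero; suc; _+_; _∸_; _≤_; _<_; s≤s; z≤n; s≤s⁻¹; _≟_)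
open import Data.Nat.Properties using (<-cmp; <⇒≤; ≤∧≢⇒<; m<1+n⇒m≤n; n<1+n; n≤1+n; n≢0⇒n>0)
open import Data.Fin as Fin using (Fin; toℕ; fromℕ<; #_)
open import Data.Fin.Properties using (toℕ-injective; toℕ-fromℕ<; toℕ<n)
  renaming (_≟_ to _≟ᶠ_)
open import Data.Product using (_×_; _,_; Σ-syntax; proj₁; proj₂)
open import Data.Product.Properties using (≡-dec)
open import Data.Sum using (_⊎_; inj₁; inj₂)
open import Data.Empty using (⊥-elim)
open import Data.List.Relation.Unary.Any using (any?)
open import Relation.Nullary.Decidable using (True; toWitness; yes; no)
open import Relation.Binary.Definitions using (Tri; tri<; tri≈; tri>)
open import Relation.Binary.PropositionalEquality
  using (_≡_; _≢_; refl; sym; trans; cong; subst)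
open import Function.Bundles using (Bijection)

Avoids : {A : Set} → A → A → A → A → Set
Avoids w x y z = w ≢ x × w ≢ y × w ≢ z

-- A fork centred at c: a walk u′ – u – c – v – v′ whose inner vertices u, v
-- are distinct from each other and from c, and whose end vertices avoid the
-- three other vertices on their side of the fork (u′ = v′ is allowed).
record Fork (G : Graph) (c : Fin (n G)) : Set where
  field
    u v u′ v′ : Fin (n G)
    c~u       : Adj G c u
    c~v       : Adj G c v
    u~u′      : Adj G u u′
    v~v′      : Adj G v v′
    u≢v       : u ≢ v
    u≢c       : u ≢ c
    v≢c       : v ≢ c
    u′-avoids : Avoids u′ c u v
    v′-avoids : Avoids v′ c v u

module Labelled (G : Graph) (f : Labeling G)
                (adj-sym : ∀ {x y} → Adj G x y → Adj G y x) where

  V : Set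
  V = Fin (n G)

  rank : V → ℕ
  rank x = toℕ (Bijection.to f x)

  rank-injective : ∀ {x y} → x ≢ y → rank x ≢ rank y
  rank-injective x≢y e = x≢y (Bijection.injective f (toℕ-injective e))

  carrier : (i : Fin (n G)) → Σ[ x ∈ V ] rank x ≡ toℕ i
  carrier i = proj₁ (Bijection.surjective f i) , cong toℕ (proj₂ (Bijection.surjective f i) refl)

  Between : V → V → V → Set
  Between x z y = (rank x < rank z × rank z < rank y) ⊎ (rank y < rank z × rank z < rank x)

  SameSide : V → V → V → Set
  SameSide c x y = (rank c < rank x × rank c < rank y) ⊎ (rank x < rank c × rank y < rank c)

  -- Edges xy and zw with rank x < rank z < rank y and w's label distinct
  -- from theirs cross or nest, according to where rank w falls.
  ordered-overlap : ∀ {x y z w} → Adj G x y → Adj G z w →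
                    rank x < rank z → rank z < rank y →
                    Avoids (rank w) (rank x) (rank z) (rank y) → HasPattern G f
  ordered-overlap {x} {y} {z} {w} x~y z~w x<z z<y (w≢x , w≢z , w≢y)
    with <-cmp (rank w) (rank x)
  ... | tri≈ _ w≡x _ = ⊥-elim (w≢x w≡x)
  ... | tri< w<x _ _ = w , x , z , y , (w<x , x<z , z<y) , inj₁ (adj-sym z~w , x~y)
  ... | tri> _ _ x<w with <-cmp (rank w) (rank z)
  ...   | tri≈ _ w≡z _ = ⊥-elim (w≢z w≡z)
  ...   | tri< w<z _ _ = x , w , z , y , (x<w , w<z , z<y) , inj₂ (x~y , adj-sym z~w)
  ...   | tri> _ _ z<w with <-cmp (rank w) (rank y)
  ...     | tri≈ _ w≡y _ = ⊥-elim (w≢y w≡y)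
  ...     | tri< w<y _ _ = x , z , w , y , (x<z , z<w , w<y) , inj₂ (x~y , z~w)
  ...     | tri> _ _ y<w = x , z , y , w , (x<z , z<y , y<w) , inj₁ (x~y , z~w)

  overlap-pattern : ∀ {x y z w} → Adj G x y → Adj G z w → Between x z y →
                    Avoids w x z y → HasPattern G f
  overlap-pattern x~y z~w (inj₁ (x<z , z<y)) (w≢x , w≢z , w≢y) =
    ordered-overlap x~y z~w x<z z<y (rank-injective w≢x , rank-injective w≢z , rank-injective w≢y)
  overlap-pattern x~y z~w (inj₂ (y<z , z<x)) (w≢x , w≢z , w≢y) =
    ordered-overlap (adj-sym x~y) z~w y<z z<x (rank-injective w≢y , rank-injective w≢z , rank-injective w≢x)

  one-between : ∀ {a b c} → a ≢ b → b ≢ c → a ≢ c →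
                Between b a c ⊎ Between a b c ⊎ Between a c b
  one-between {a} {b} {c} a≢b b≢c a≢c
    with <-cmp (rank a) (rank b) | <-cmp (rank b) (rank c) | <-cmp (rank a) (rank c)
  ... | tri≈ _ e _ | _          | _          = ⊥-elim (rank-injective a≢b e)
  ... | _          | tri≈ _ e _ | _          = ⊥-elim (rank-injective b≢c e)
  ... | _          | _          | tri≈ _ e _ = ⊥-elim (rank-injective a≢c e)
  ... | tri< a<b _ _ | tri< b<c _ _ | _            = inj₂ (inj₁ (inj₁ (a<b , b<c)))
  ... | tri> _ _ b<a | tri> _ _ c<b | _            = inj₂ (inj₁ (inj₂ (c<b , b<a)))
  ... | tri< a<b _ _ | tri> _ _ c<b | tri< a<c _ _ = inj₂ (inj₂ (inj₁ (a<c , c<b)))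
  ... | tri< a<b _ _ | tri> _ _ c<b | tri> _ _ c<a = inj₁ (inj₂ (c<a , a<b))
  ... | tri> _ _ b<a | tri< b<c _ _ | tri< a<c _ _ = inj₁ (inj₁ (b<a , a<c))
  ... | tri> _ _ b<a | tri< b<c _ _ | tri> _ _ c<a = inj₂ (inj₂ (inj₂ (b<c , c<a)))

  -- A triangle abc with pendant edges aa′, bb′, cc′ leaving it: the middle
  -- vertex of the triangle lies inside the opposite side.
  pendant-triangle : ∀ {a b c a′ b′ c′} →
    Adj G a b → Adj G b c → Adj G a c →
    Adj G a a′ → Adj G b b′ → Adj G c c′ → a ≢ b → b ≢ c → a ≢ c →
    Avoids a′ b a c → Avoids b′ a b c → Avoids c′ a c b → HasPattern G f
  pendant-triangle a~b b~c a~c a~a′ b~b′ c~c′ a≢b b≢c a≢c a′-out b′-out c′-out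
    with one-between a≢b b≢c a≢c
  ... | inj₁ a-middle        = overlap-pattern b~c a~a′ a-middle a′-out
  ... | inj₂ (inj₁ b-middle) = overlap-pattern a~c b~b′ b-middle b′-out
  ... | inj₂ (inj₂ c-middle) = overlap-pattern a~b c~c′ c-middle c′-out

  fork-pattern : ∀ {c} (F : Fork G c) → SameSide c (Fork.u F) (Fork.v F) → HasPattern G f
  fork-pattern {c} F side = by-order side (<-cmp (rank u) (rank v))
    where
      open Fork F
      by-order : SameSide c u v → Tri (rank u < rank v) (rank u ≡ rank v) (rank v < rank u) →
                 HasPattern G f
      by-order _                (tri≈ _ e _)   = ⊥-elim (rank-injective u≢v e)
      by-order (inj₁ (c<u , _)) (tri< u<v _ _) = overlap-pattern c~v u~u′ (inj₁ (c<u , u<v)) u′-avoids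
      by-order (inj₁ (_ , c<v)) (tri> _ _ v<u) = overlap-pattern c~u v~v′ (inj₁ (c<v , v<u)) v′-avoids
      by-order (inj₂ (_ , v<c)) (tri< u<v _ _) = overlap-pattern c~u v~v′ (inj₂ (u<v , v<c)) v′-avoids
      by-order (inj₂ (u<c , _)) (tri> _ _ v<u) = overlap-pattern c~v u~u′ (inj₂ (v<u , u<c)) u′-avoids

  two-on-one-side : ∀ {c a b d} → a ≢ c → b ≢ c → d ≢ c →
                    SameSide c a b ⊎ SameSide c a d ⊎ SameSide c b d
  two-on-one-side {c} {a} {b} {d} a≢c b≢c d≢c
    with <-cmp (rank c) (rank a) | <-cmp (rank c) (rank b) | <-cmp (rank c) (rank d)
  ... | tri≈ _ e _ | _          | _          = ⊥-elim (rank-injective a≢c (sym e))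
  ... | _          | tri≈ _ e _ | _          = ⊥-elim (rank-injective b≢c (sym e))
  ... | _          | _          | tri≈ _ e _ = ⊥-elim (rank-injective d≢c (sym e))
  ... | tri< p _ _ | tri< q _ _ | _          = inj₁ (inj₁ (p , q))
  ... | tri> _ _ p | tri> _ _ q | _          = inj₁ (inj₂ (p , q))
  ... | tri< p _ _ | tri> _ _ _ | tri< r _ _ = inj₂ (inj₁ (inj₁ (p , r)))
  ... | tri> _ _ p | tri< _ _ _ | tri> _ _ r = inj₂ (inj₁ (inj₂ (p , r)))
  ... | tri< _ _ _ | tri> _ _ q | tri> _ _ r = inj₂ (inj₂ (inj₂ (q , r)))
  ... | tri> _ _ _ | tri< q _ _ | tri< r _ _ = inj₂ (inj₂ (inj₁ (q , r)))

  -- A fork centred at the vertex labelled 0 has both inner vertices above it.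
  fork-at-minimum : ∀ {m} → rank m ≡ 0 → Fork G m → HasPattern G f
  fork-at-minimum {m} m-least F =
    fork-pattern F (inj₁ (above (Fork.u≢c F) , above (Fork.v≢c F)))
    where
      above : ∀ {x} → x ≢ m → rank m < rank x
      above {x} x≢m = subst (_< rank x) (sym m-least)
                        (n≢0⇒n>0 (λ e → rank-injective x≢m (trans e (sym m-least))))

fromEdges-symmetric : ∀ {m es} {x y : Fin m} →
                      Adj (fromEdges m es) x y → Adj (fromEdges m es) y x
fromEdges-symmetric (inj₁ xy∈es) = inj₂ xy∈es
fromEdges-symmetric (inj₂ yx∈es) = inj₁ yx∈es

listed : ∀ {m es} (x y : Fin m) → {True (any? (≡-dec _≟ᶠ_ _≟ᶠ_ (x , y)) es)} → Adj (fromEdges m es) x y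
listed x y {found} = inj₁ (toWitness found)

T₁-fork₁₂ T₁-fork₁₃ T₁-fork₂₃ : Fork T₁ (# 0)
T₁-fork₁₂ = record
  { u = # 1 ; v = # 2 ; u′ = # 4 ; v′ = # 5
  ; c~u = listed (# 0) (# 1) ; c~v = listed (# 0) (# 2)
  ; u~u′ = listed (# 1) (# 4) ; v~v′ = listed (# 2) (# 5)
  ; u≢v = λ () ; u≢c = λ () ; v≢c = λ ()
  ; u′-avoids = (λ ()) , (λ ()) , (λ ()) ; v′-avoids = (λ ()) , (λ ()) , (λ ()) }
T₁-fork₁₃ = record
  { u = # 1 ; v = # 3 ; u′ = # 4 ; v′ = # 6
  ; c~u = listed (# 0) (# 1) ; c~v = listed (# 0) (# 3)
  ; u~u′ = listed (# 1) (# 4) ; v~v′ = listed (# 3) (# 6)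
  ; u≢v = λ () ; u≢c = λ () ; v≢c = λ ()
  ; u′-avoids = (λ ()) , (λ ()) , (λ ()) ; v′-avoids = (λ ()) , (λ ()) , (λ ()) }
T₁-fork₂₃ = record
  { u = # 2 ; v = # 3 ; u′ = # 5 ; v′ = # 6
  ; c~u = listed (# 0) (# 2) ; c~v = listed (# 0) (# 3)
  ; u~u′ = listed (# 2) (# 5) ; v~v′ = listed (# 3) (# 6)
  ; u≢v = λ () ; u≢c = λ () ; v≢c = λ ()
  ; u′-avoids = (λ ()) , (λ ()) , (λ ()) ; v′-avoids = (λ ()) , (λ ()) , (λ ()) }

-- T₁: two legs at the centre point the same way and form a fork.
T₁-pattern : (f : Labeling T₁) → HasPattern T₁ f
T₁-pattern f = from-pair (two-on-one-side {# 0} {# 1} {# 2} {# 3} (λ ()) (λ ()) (λ ()))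
  where
    open Labelled T₁ f fromEdges-symmetric
    from-pair : SameSide (# 0) (# 1) (# 2) ⊎ SameSide (# 0) (# 1) (# 3) ⊎ SameSide (# 0) (# 2) (# 3) →
                HasPattern T₁ f
    from-pair (inj₁ side)        = fork-pattern T₁-fork₁₂ side
    from-pair (inj₂ (inj₁ side)) = fork-pattern T₁-fork₁₃ side
    from-pair (inj₂ (inj₂ side)) = fork-pattern T₁-fork₂₃ side

T₂-pattern : (f : Labeling T₂) → HasPattern T₂ f
T₂-pattern f =
  pendant-triangle (listed (# 0) (# 1)) (listed (# 1) (# 2)) (listed (# 0) (# 2))
                   (listed (# 0) (# 3)) (listed (# 1) (# 4)) (listed (# 2) (# 5))
                   (λ ()) (λ ()) (λ ())
                   ((λ ()) , (λ ()) , (λ ())) ((λ ()) , (λ ()) , (λ ())) ((λ ()) , (λ ()) , (λ ()))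
  where open Labelled T₂ f fromEdges-symmetric

Cyclic : ℕ → ℕ → ℕ → Set
Cyclic k a b = (b ≡ suc a) ⊎ (a ≡ suc b) ⊎ ((a ≡ 0) × (b ≡ k ∸ 1)) ⊎ ((b ≡ 0) × (a ≡ k ∸ 1))

C-symmetric : ∀ {k} {x y : Fin (n (C k))} → Adj (C k) x y → Adj (C k) y x
C-symmetric (inj₁ y≡1+x)               = inj₂ (inj₁ y≡1+x)
C-symmetric (inj₂ (inj₁ x≡1+y))        = inj₁ x≡1+y
C-symmetric (inj₂ (inj₂ (inj₁ ends)))  = inj₂ (inj₂ (inj₂ ends))
C-symmetric (inj₂ (inj₂ (inj₂ ends)))  = inj₂ (inj₂ (inj₁ ends))

record CycleFork (k c : ℕ) : Set where
  field
    u v u′ v′ : ℕ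
    u<k       : u < k
    v<k       : v < k
    u′<k      : u′ < k
    v′<k      : v′ < k
    c~u       : Cyclic k c u
    c~v       : Cyclic k c v
    u~u′      : Cyclic k u u′
    v~v′      : Cyclic k v v′
    u≢v       : u ≢ v
    u≢c       : u ≢ c
    v≢c       : v ≢ c
    u′-avoids : Avoids u′ c u v
    v′-avoids : Avoids v′ c v u

-- In C (4 + j) every position is the centre of a fork: its two neighbours
-- and their further neighbours, which are distinct as the cycle has length
-- at least 4.  The cases are the first two positions, the last two, and the
-- interior ones.
cycle-fork-at : ∀ j c → c < 4 + j → CycleFork (4 + j) c
cycle-fork-at j zero _ = record
  { u = 1 ; v = 3 + j ; u′ = 2 ; v′ = 2 + j
  ; u<k = s≤s (s≤s z≤n) ; v<k = n<1+n _ ; u′<k = s≤s (s≤s (s≤s z≤n)) ; v′<k = s≤s (s≤s (s≤s (n≤1+n j)))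
  ; c~u = inj₁ refl ; c~v = inj₂ (inj₂ (inj₁ (refl , refl)))
  ; u~u′ = inj₁ refl ; v~v′ = inj₂ (inj₁ refl)
  ; u≢v = λ () ; u≢c = λ () ; v≢c = λ ()
  ; u′-avoids = (λ ()) , (λ ()) , (λ ()) ; v′-avoids = (λ ()) , (λ ()) , (λ ()) }
cycle-fork-at j (suc zero) _ = record
  { u = 0 ; v = 2 ; u′ = 3 + j ; v′ = 3
  ; u<k = s≤s z≤n ; v<k = s≤s (s≤s (s≤s z≤n)) ; u′<k = n<1+n _ ; v′<k = s≤s (s≤s (s≤s (s≤s z≤n)))
  ; c~u = inj₂ (inj₁ refl) ; c~v = inj₁ refl
  ; u~u′ = inj₂ (inj₂ (inj₁ (refl , refl))) ; v~v′ = inj₁ refl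
  ; u≢v = λ () ; u≢c = λ () ; v≢c = λ ()
  ; u′-avoids = (λ ()) , (λ ()) , (λ ()) ; v′-avoids = (λ ()) , (λ ()) , (λ ()) }
cycle-fork-at j (suc (suc i)) c<k with i ≟ j | i ≟ suc j
-- c = k - 2
... | yes refl | _ = record
  { u = 1 + j ; v = 3 + j ; u′ = j ; v′ = 0
  ; u<k = <⇒≤ c<k ; v<k = n<1+n _ ; u′<k = <⇒≤ (<⇒≤ c<k) ; v′<k = s≤s z≤n
  ; c~u = inj₂ (inj₁ refl) ; c~v = inj₁ refl
  ; u~u′ = inj₂ (inj₁ refl) ; v~v′ = inj₂ (inj₂ (inj₂ (refl , refl)))
  ; u≢v = λ () ; u≢c = λ () ; v≢c = λ ()
  ; u′-avoids = (λ ()) , (λ ()) , (λ ()) ; v′-avoids = (λ ()) , (λ ()) , (λ ()) }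
-- c = k - 1
... | no _ | yes refl = record
  { u = 2 + j ; v = 0 ; u′ = 1 + j ; v′ = 1
  ; u<k = <⇒≤ c<k ; v<k = s≤s z≤n ; u′<k = <⇒≤ (<⇒≤ c<k) ; v′<k = s≤s (s≤s z≤n)
  ; c~u = inj₂ (inj₁ refl) ; c~v = inj₂ (inj₂ (inj₂ (refl , refl)))
  ; u~u′ = inj₂ (inj₁ refl) ; v~v′ = inj₁ refl
  ; u≢v = λ () ; u≢c = λ () ; v≢c = λ ()
  ; u′-avoids = (λ ()) , (λ ()) , (λ ()) ; v′-avoids = (λ ()) , (λ ()) , (λ ()) }
-- 2 ≤ c ≤ k - 3
... | no i≢j | no i≢1+j = record
  { u = 1 + i ; v = 3 + i ; u′ = i ; v′ = 4 + i
  ; u<k = <⇒≤ c<k ; v<k = <⇒≤ 4+i<k ; u′<k = <⇒≤ (<⇒≤ c<k) ; v′<k = 4+i<k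
  ; c~u = inj₂ (inj₁ refl) ; c~v = inj₁ refl
  ; u~u′ = inj₂ (inj₁ refl) ; v~v′ = inj₁ refl
  ; u≢v = λ () ; u≢c = λ () ; v≢c = λ ()
  ; u′-avoids = (λ ()) , (λ ()) , (λ ()) ; v′-avoids = (λ ()) , (λ ()) , (λ ()) }
  where
    -- c is neither of the last two positions, so c + 2 < k.
    4+i<k : 4 + i < 4 + j
    4+i<k = s≤s (s≤s (s≤s (s≤s
              (≤∧≢⇒< (m<1+n⇒m≤n (≤∧≢⇒< (s≤s⁻¹ (s≤s⁻¹ (s≤s⁻¹ c<k))) i≢1+j)) i≢j))))

cycle-fork : ∀ {k} (c : Fin k) → CycleFork k (toℕ c) → Fork (C k) c
cycle-fork {k} c P = record
  { u = fromℕ< u<k ; v = fromℕ< v<k ; u′ = fromℕ< u′<k ; v′ = fromℕ< v′<k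
  ; c~u = adjacent refl (toℕ-fromℕ< u<k) c~u ; c~v = adjacent refl (toℕ-fromℕ< v<k) c~v
  ; u~u′ = adjacent (toℕ-fromℕ< u<k) (toℕ-fromℕ< u′<k) u~u′
  ; v~v′ = adjacent (toℕ-fromℕ< v<k) (toℕ-fromℕ< v′<k) v~v′
  ; u≢v = distinct (toℕ-fromℕ< u<k) (toℕ-fromℕ< v<k) u≢v
  ; u≢c = distinct (toℕ-fromℕ< u<k) refl u≢c
  ; v≢c = distinct (toℕ-fromℕ< v<k) refl v≢c
  ; u′-avoids = avoids (toℕ-fromℕ< u′<k) refl (toℕ-fromℕ< u<k) (toℕ-fromℕ< v<k) u′-avoids
  ; v′-avoids = avoids (toℕ-fromℕ< v′<k) refl (toℕ-fromℕ< v<k) (toℕ-fromℕ< u<k) v′-avoids }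
  where
    open CycleFork P
    adjacent : ∀ {x y : Fin k} {a b} → toℕ x ≡ a → toℕ y ≡ b → Cyclic k a b → Adj (C k) x y
    adjacent refl refl a~b = a~b
    distinct : ∀ {x y : Fin k} {a b} → toℕ x ≡ a → toℕ y ≡ b → a ≢ b → x ≢ y
    distinct refl refl a≢b x≡y = a≢b (cong toℕ x≡y)
    avoids : ∀ {w x y z : Fin k} {a b c d} → toℕ w ≡ a → toℕ x ≡ b → toℕ y ≡ c → toℕ z ≡ d →
             Avoids a b c d → Avoids w x y z
    avoids w≡a x≡b y≡c z≡d (a≢b , a≢c , a≢d) =
      distinct w≡a x≡b a≢b , distinct w≡a y≡c a≢c , distinct w≡a z≡d a≢d

cycle-pattern : (k : ℕ) → 4 ≤ k → (f : Labeling (C k)) → HasPattern (C k) f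
cycle-pattern (suc (suc (suc (suc j)))) (s≤s (s≤s (s≤s (s≤s _)))) f =
  fork-at-minimum least (cycle-fork m (cycle-fork-at j (toℕ m) (toℕ<n m)))
  where
    open Labelled (C (4 + j)) f C-symmetric
    m : V
    m = proj₁ (carrier Fin.zero)
    least : rank m ≡ 0
    least = proj₂ (carrier Fin.zero)

lemma1 : ((f : Labeling T₁) → HasPattern T₁ f)
       × ((f : Labeling T₂) → HasPattern T₂ f)
       × ((k : ℕ) → 4 ≤ k → (f : Labeling (C k)) → HasPattern (C k) f)
lemma1 = T₁-pattern , T₂-pattern , cycle-pattern
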